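{- Every Abelian Sandpile Model is equivalent to a simple Abelian Sandpile Model, i.e. for every ASM there is an ASM in which each vertex is fired at most once in any execution and whose generated lattice is isomorphic to that of the original one.
   Context: Chip Firing Games: $G$ a finite directed multigraph, $E(u,v)$ the number of edges from $u$ to $v$, $deg^{+}(v)=\sum_uE(v,u)$; a sink is a vertex all of whose outgoing edges are loops. A configuration is a map $V(G)\to\mathbb{N}$; a non-sink $v$ is firable in $c$ if $c(v)\ge deg^{+}(v)$, and firing moves one chip from $v$ along each outgoing edge. $CFG(G,\mathcal{O})$ is the set of configurations reachable from $\mathcal{O}$, ordered by reachability; it is a lattice (the generated lattice) when there is no infinite firing sequence. An execution is a sequence of firings starting at $\mathcal{O}$. A game is simple if each vertex is fired at most once in any execution reaching the fixed point. Two games are equivalent if their generated lattices are isomorphic. An Abelian Sandpile Model (ASM) is a game $CFG(G,\mathcal{O})$ with $G$ connected, having exactly one sink $s$, and $E(v_1,v_2)=E(v_2,v_1)$ for all distinct $v_1,v_2\neq s$. -}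

module Defs where

open import Data.Nat using (ℕ; zero; suc; _+_; _∸_; _≤_; _<_)
open import Data.Fin using (Fin)
open import Data.Fin.Properties using (_≟_)
open import Data.Vec using (Vec; lookup; tabulate; sum)
open import Data.List using (List; []; _∷_)
open import Data.List.Relation.Unary.Unique.Propositional using (Unique)
open import Data.Product using (Σ; ∃; ∃-syntax; _×_; _,_; proj₁)
open import Data.Sum using (_⊎_)
open import Relation.Nullary using (¬_; yes; no)
open import Relation.Binary.PropositionalEquality using (_≡_; _≢_)
open import Relation.Binary.Construct.Closure.ReflexiveTransitive using (Star)
open import Function.Bundles using (_⇔_)

-- A finite directed multigraph on vertex set Fin n:
-- E u v = number of edges from u to v (loops allowed).
Graph : ℕ → Set
Graph n = Fin n → Fin n → ℕ

Config : ℕ → Set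
Config n = Vec ℕ n

deg : ∀ {n} → Graph n → Fin n → ℕ
deg E v = sum (tabulate (E v))

IsSink : ∀ {n} → Graph n → Fin n → Set
IsSink E v = ∀ u → u ≢ v → E v u ≡ 0

Firable : ∀ {n} → Graph n → Fin n → Config n → Set
Firable E v c = (¬ IsSink E v) × (deg E v ≤ lookup c v)

fire : ∀ {n} → Graph n → Fin n → Config n → Config n
fire E v c = tabulate λ u → base u + E v u
  where
  base : _ → ℕ
  base u with u ≟ v
  ... | yes _ = lookup c u ∸ deg E v
  ... | no  _ = lookup c u

data Exec {n} (E : Graph n) : Config n → List (Fin n) → Config n → Set where
  done : ∀ {c} → Exec E c [] c
  step : ∀ {c v vs d} → Firable E v c → Exec E (fire E v c) vs d → Exec E c (v ∷ vs) d

Reach : ∀ {n} → Graph n → Config n → Config n → Set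
Reach E c d = ∃[ vs ] Exec E c vs d

Stable : ∀ {n} → Graph n → Config n → Set
Stable E c = ∀ v → ¬ Firable E v c

Simple : ∀ {n} → Graph n → Config n → Set
Simple E O = ∀ vs d → Exec E O vs d → Stable E d → Unique vs

Adj : ∀ {n} → Graph n → Fin n → Fin n → Set
Adj E u v = (0 < E u v) ⊎ (0 < E v u)

Connected : ∀ {n} → Graph n → Set
Connected E = ∀ u v → Star (Adj E) u v

IsASM : ∀ {n} → Graph n → Config n → Set
IsASM E O = Connected E × (Σ _ λ s → IsSink E s × (∀ v → IsSink E v → v ≡ s)
  × (∀ v₁ v₂ → v₁ ≢ v₂ → v₁ ≢ s → v₂ ≢ s → E v₁ v₂ ≡ E v₂ v₁))

CFG : ∀ {n} → Graph n → Config n → Set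
CFG E O = Σ (Config _) (Reach E O)

-- Equivalence: the generated posets (ordered by reachability) are
-- order-isomorphic (= lattice isomorphism of the generated lattices).
Equivalent : ∀ {n m} → Graph n → Config n → Graph m → Config m → Set
Equivalent {n} {m} E O E' O' =
  Σ (CFG E O → CFG E' O') λ f →
  Σ (CFG E' O' → CFG E O) λ g →
    (∀ x → proj₁ (g (f x)) ≡ proj₁ x)
  × (∀ y → proj₁ (f (g y)) ≡ proj₁ y)
  × (∀ x y → Reach E (proj₁ x) (proj₁ y) ⇔ Reach E' (proj₁ (f x)) (proj₁ (f y)))

-- A configuration c
-- reached by an execution with shot vector x (x u = number of firings of u)
-- satisfies the balance equation
--     c u + deg u · x u  =  O u + Σ_w E w u · x w ,
-- so x determines c; conversely, in an ASM the shot vector is determined by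
-- c (an excess of shots would have to flow along a path to the sink), and
-- the shot vectors of reachable configurations are bounded by some N.
--
-- The simple ASM E' has one vertex (u , j) for every non-sink u and j ≤ N:
-- copy j of u stands for the (j+1)-st firing of u.  Copies of u form a path
-- with huge weight B (so they fire in order), every copy of u is joined to
-- every copy of w with E u w edges, and the remaining degree goes to the
-- sink, with thresholds chosen so that copy (u , x u) is firable in the
-- image x of c exactly when u is firable in c.  Firing copy (u , x u) maps
-- image x to image (x + δᵤ), so executions of E and E' correspond (forward
-- and backward simulation), no copy fires twice, and c ↦ image x is an
-- isomorphism of the reachability orders.
module Submission where

open import Defs
open import Data.Nat hiding (_≟_)
open import Data.Nat.Properties hiding (_≟_)
open import Data.Nat.Tactic.RingSolver using (solve-∀)
open import Data.Empty using (⊥; ⊥-elim)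
open import Data.Fin using (Fin; zero; suc; toℕ; fromℕ<; combine; remQuot)
open import Data.Fin.Properties
  using (_≟_; remQuot-combine; combine-remQuot; toℕ-injective; toℕ-fromℕ<)
  renaming (suc-injective to fin-suc-injective)
open import Data.Vec using (Vec; lookup; tabulate; sum)
open import Data.Vec.Properties using (lookup∘tabulate; tabulate∘lookup; tabulate-cong)
open import Data.List using (List; []; _∷_; _++_)
open import Data.List.Properties using (++-assoc; ++-identityʳ)
open import Data.List.Relation.Unary.All as All using (All; []; _∷_)
open import Data.List.Relation.Unary.AllPairs using ([]; _∷_)
open import Data.List.Relation.Unary.Unique.Propositional using (Unique)
open import Data.Product using (Σ; ∃; _×_; _,_; proj₁; proj₂)
open import Data.Sum using (inj₁; inj₂)
open import Relation.Nullary using (¬_; yes; no; Dec)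
open import Relation.Binary.PropositionalEquality
open import Relation.Binary.Definitions using (tri<; tri≈; tri>)
open import Relation.Binary.Construct.Closure.ReflexiveTransitive using (Star; ε; _◅_; _◅◅_)
open import Function using (_∋_)
open import Function.Bundles using (_⇔_; mk⇔)

ΣT : ∀ {n} → (Fin n → ℕ) → ℕ
ΣT f = sum (tabulate f)

ΣT-ext : ∀ {n} (f g : Fin n → ℕ) → (∀ i → f i ≡ g i) → ΣT f ≡ ΣT g
ΣT-ext {zero} f g h = refl
ΣT-ext {suc n} f g h = cong₂ _+_ (h zero) (ΣT-ext (λ i → f (suc i)) (λ i → g (suc i)) (λ i → h (suc i)))

ΣT-zero : ∀ {n} → ΣT {n} (λ _ → 0) ≡ 0
ΣT-zero {zero} = refl
ΣT-zero {suc n} = ΣT-zero {n}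

ΣT-+ : ∀ {n} (f g : Fin n → ℕ) → ΣT (λ i → f i + g i) ≡ ΣT f + ΣT g
ΣT-+ {zero} f g = refl
ΣT-+ {suc n} f g =
  trans (cong (f zero + g zero +_) (ΣT-+ (λ i → f (suc i)) (λ i → g (suc i))))
        (swap-middle (f zero) (g zero) _ _)
  where
  swap-middle : ∀ a b c d → a + b + (c + d) ≡ a + c + (b + d)
  swap-middle = solve-∀

ΣT-* : ∀ {n} k (f : Fin n → ℕ) → ΣT (λ i → k * f i) ≡ k * ΣT f
ΣT-* {zero} k f = sym (*-zeroʳ k)
ΣT-* {suc n} k f =
  trans (cong (k * f zero +_) (ΣT-* k (λ i → f (suc i)))) (sym (*-distribˡ-+ k (f zero) _))

ΣT-mono : ∀ {n} (f g : Fin n → ℕ) → (∀ i → f i ≤ g i) → ΣT f ≤ ΣT g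
ΣT-mono {zero} f g h = z≤n
ΣT-mono {suc n} f g h =
  +-mono-≤ (h zero) (ΣT-mono (λ i → f (suc i)) (λ i → g (suc i)) (λ i → h (suc i)))

ΣT-≤ : ∀ {n} (f : Fin n → ℕ) i → f i ≤ ΣT f
ΣT-≤ f zero = m≤m+n _ _
ΣT-≤ f (suc i) = ≤-trans (ΣT-≤ (λ i → f (suc i)) i) (m≤n+m _ (f zero))

ΣT-equal : ∀ {n} (f g : Fin n → ℕ) → (∀ i → f i ≤ g i) → ΣT f ≡ ΣT g → ∀ i → f i ≡ g i
ΣT-equal {suc n} f g f≤g sum≡ = go
  where
  tail≤ : ΣT (λ i → f (suc i)) ≤ ΣT (λ i → g (suc i))
  tail≤ = ΣT-mono (λ i → f (suc i)) (λ i → g (suc i)) (λ i → f≤g (suc i))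
  head≡ : f zero ≡ g zero
  head≡ = ≤-antisym (f≤g zero) (+-cancelʳ-≤ (ΣT (λ i → f (suc i))) (g zero) (f zero)
            (≤-trans (+-monoʳ-≤ (g zero) tail≤) (≤-reflexive (sym sum≡))))
  go : ∀ i → f i ≡ g i
  go zero = head≡
  go (suc i) = ΣT-equal (λ i → f (suc i)) (λ i → g (suc i)) (λ i → f≤g (suc i))
                 (+-cancelˡ-≡ (f zero) _ _ (trans sum≡ (cong (_+ _) (sym head≡)))) i

ΣT-point : ∀ {n} (v : Fin n) k (f g : Fin n → ℕ) →
           (∀ i → i ≢ v → g i ≡ f i) → g v + k ≡ f v → ΣT g + k ≡ ΣT f
ΣT-point {suc n} zero k f g same at-v =
  trans (swap-last (g zero) _ k) (cong₂ _+_ at-v (ΣT-ext _ _ (λ i → same (suc i) (λ ()))))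
  where
  swap-last : ∀ a b c → a + b + c ≡ a + c + b
  swap-last = solve-∀
ΣT-point {suc n} (suc v) k f g same at-v =
  trans (+-assoc (g zero) _ k)
        (cong₂ _+_ (same zero (λ ()))
                   (ΣT-point v k (λ i → f (suc i)) (λ i → g (suc i))
                      (λ i i≢v → same (suc i) (λ eq → i≢v (fin-suc-injective eq))) at-v))

sum-ΣT : ∀ {n} (c : Vec ℕ n) → sum c ≡ ΣT (lookup c)
sum-ΣT c = cong sum (sym (tabulate∘lookup c))

vec-ext : ∀ {n} (c d : Vec ℕ n) → (∀ i → lookup c i ≡ lookup d i) → c ≡ d
vec-ext c d h = trans (sym (tabulate∘lookup c)) (trans (tabulate-cong h) (tabulate∘lookup d))

fire-other : ∀ {n} (E : Graph n) v c u → u ≢ v → lookup (fire E v c) u ≡ lookup c u + E v u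
fire-other E v c u u≢v rewrite (lookup (fire E v c) u ≡ _ ∋ lookup∘tabulate _ u) with u ≟ v
... | yes u≡v = ⊥-elim (u≢v u≡v)
... | no _ = refl

fire-self : ∀ {n} (E : Graph n) v c → lookup (fire E v c) v ≡ (lookup c v ∸ deg E v) + E v v
fire-self E v c rewrite (lookup (fire E v c) v ≡ _ ∋ lookup∘tabulate _ v) with v ≟ v
... | yes _ = refl
... | no v≢v = ⊥-elim (v≢v refl)

δ : ∀ {n} → Fin n → Fin n → ℕ
δ u w with u ≟ w
... | yes _ = 1
... | no _ = 0

δ-same : ∀ {n} (u : Fin n) → δ u u ≡ 1
δ-same u with u ≟ u
... | yes _ = refl
... | no u≢u = ⊥-elim (u≢u refl)

δ-other : ∀ {n} (u w : Fin n) → u ≢ w → δ u w ≡ 0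
δ-other u w u≢w with u ≟ w
... | yes u≡w = ⊥-elim (u≢w u≡w)
... | no _ = refl

cnt : ∀ {n} → List (Fin n) → Fin n → ℕ
cnt [] w = 0
cnt (u ∷ us) w = δ u w + cnt us w

cnt-++ : ∀ {n} (as bs : List (Fin n)) w → cnt (as ++ bs) w ≡ cnt as w + cnt bs w
cnt-++ [] bs w = refl
cnt-++ (a ∷ as) bs w = trans (cong (δ a w +_) (cnt-++ as bs w)) (sym (+-assoc (δ a w) _ _))

cnt-snoc : ∀ {n} (vs : List (Fin n)) v w → cnt (vs ++ v ∷ []) w ≡ cnt vs w + δ v w
cnt-snoc vs v w = trans (cnt-++ vs (v ∷ []) w) (cong (cnt vs w +_) (+-identityʳ (δ v w)))

exec-++ : ∀ {n} {E : Graph n} {c vs d ws e} → Exec E c vs d → Exec E d ws e → Exec E c (vs ++ ws) e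
exec-++ done e2 = e2
exec-++ (step f e1) e2 = step f (exec-++ e1 e2)

exec-snoc : ∀ {n} {E : Graph n} {c vs d} v → Exec E c vs d → Firable E v d →
            Exec E c (vs ++ v ∷ []) (fire E v d)
exec-snoc v ex f = exec-++ ex (step f done)

bump : ∀ {n} → (Fin n → ℕ) → Fin n → Fin n → ℕ
bump x v w = x w + δ v w

bump-self : ∀ {n} (x : Fin n → ℕ) v → bump x v v ≡ suc (x v)
bump-self x v = trans (cong (x v +_) (δ-same v)) (+-comm (x v) 1)

bump-other : ∀ {n} (x : Fin n → ℕ) v u → u ≢ v → bump x v u ≡ x u
bump-other x v u u≢v = trans (cong (x u +_) (δ-other v u (λ e → u≢v (sym e)))) (+-identityʳ (x u))

ΣT-bump : ∀ {n} (a x : Fin n → ℕ) v → ΣT (λ u → a u * bump x v u) ≡ ΣT (λ u → a u * x u) + a v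
ΣT-bump a x v = sym (ΣT-point v (a v) _ _
  (λ u u≢v → cong (a u *_) (sym (bump-other x v u u≢v)))
  (trans (times-suc (a v) (x v)) (cong (a v *_) (sym (bump-self x v)))))
  where
  times-suc : ∀ a b → a * b + a ≡ a * suc b
  times-suc = solve-∀

-- The balance equation between a shot vector x and a configuration c:
-- every chip on v is either initial or received, minus those sent away.
module Balance {n} (E : Graph n) (O : Config n) where

  received : (Fin n → ℕ) → Fin n → ℕ
  received x v = ΣT (λ u → E u v * x u)

  Balanced : (Fin n → ℕ) → Config n → Set
  Balanced x c = ∀ v → lookup c v + deg E v * x v ≡ lookup O v + received x v

  received-cong : ∀ x y → (∀ w → x w ≡ y w) → ∀ v → received x v ≡ received y v
  received-cong x y x≡y v = ΣT-ext _ _ (λ u → cong (E u v *_) (x≡y u))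

  Balanced-cong : ∀ x y c → (∀ w → x w ≡ y w) → Balanced x c → Balanced y c
  Balanced-cong x y c x≡y bal v =
    trans (cong (λ z → lookup c v + deg E v * z) (sym (x≡y v)))
          (trans (bal v) (cong (lookup O v +_) (received-cong x y x≡y v)))

  balanced-fire : ∀ x c v → Balanced x c → Firable E v c → Balanced (bump x v) (fire E v c)
  balanced-fire x c v bal (_ , deg≤c) w with w ≟ v
  ... | no w≢v = begin
        lookup (fire E v c) w + deg E w * bump x v w
          ≡⟨ cong₂ (λ a b → a + deg E w * b) (fire-other E v c w w≢v) (bump-other x v w w≢v) ⟩
        lookup c w + E v w + deg E w * x w
          ≡⟨ swap-last (lookup c w) (E v w) _ ⟩
        (lookup c w + deg E w * x w) + E v w
          ≡⟨ cong (_+ E v w) (bal w) ⟩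
        lookup O w + received x w + E v w
          ≡⟨ +-assoc (lookup O w) _ _ ⟩
        lookup O w + (received x w + E v w)
          ≡⟨ cong (lookup O w +_) (sym (ΣT-bump (λ u → E u w) x v)) ⟩
        lookup O w + received (bump x v) w ∎
    where
    open ≡-Reasoning
    swap-last : ∀ a b c → a + b + c ≡ a + c + b
    swap-last = solve-∀
  ... | yes refl = begin
        lookup (fire E v c) v + deg E v * bump x v v
          ≡⟨ cong₂ (λ a b → a + deg E v * b) (fire-self E v c) (bump-self x v) ⟩
        (lookup c v ∸ deg E v) + E v v + deg E v * suc (x v)
          ≡⟨ regroup (lookup c v ∸ deg E v) (E v v) (deg E v) (x v) ⟩
        ((lookup c v ∸ deg E v) + deg E v) + deg E v * x v + E v v
          ≡⟨ cong (λ z → z + deg E v * x v + E v v) (m∸n+n≡m deg≤c) ⟩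
        (lookup c v + deg E v * x v) + E v v
          ≡⟨ cong (_+ E v v) (bal v) ⟩
        lookup O v + received x v + E v v
          ≡⟨ +-assoc (lookup O v) _ _ ⟩
        lookup O v + (received x v + E v v)
          ≡⟨ cong (lookup O v +_) (sym (ΣT-bump (λ u → E u v) x v)) ⟩
        lookup O v + received (bump x v) v ∎
    where
    open ≡-Reasoning
    regroup : ∀ a e d x → a + e + d * suc x ≡ a + d + d * x + e
    regroup = solve-∀

  balanced-exec : ∀ x c vs d → Balanced x c → Exec E c vs d → Balanced (λ w → x w + cnt vs w) d
  balanced-exec x c [] d bal done = Balanced-cong x _ c (λ w → sym (+-identityʳ (x w))) bal
  balanced-exec x c (v ∷ vs) d bal (step f ex) =
    Balanced-cong _ _ d (λ w → +-assoc (x w) (δ v w) (cnt vs w))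
      (balanced-exec (bump x v) _ vs d (balanced-fire x c v bal f) ex)

  balanced-start : Balanced (λ _ → 0) O
  balanced-start v =
    cong (lookup O v +_) (trans (*-zeroʳ (deg E v))
      (sym (trans (ΣT-ext _ (λ _ → 0) (λ u → *-zeroʳ (E u v))) (ΣT-zero {n}))))

  balanced-reach : ∀ vs d → Exec E O vs d → Balanced (cnt vs) d
  balanced-reach vs d ex = balanced-exec (λ _ → 0) O vs d balanced-start ex

  balance-determines : ∀ x y c d → (∀ w → x w ≡ y w) → Balanced x c → Balanced y d → c ≡ d
  balance-determines x y c d x≡y balx baly = vec-ext c d (λ v →
    +-cancelʳ-≡ _ (lookup c v) (lookup d v)
      (trans (balx v) (trans (cong (lookup O v +_) (received-cong x y x≡y v))
        (trans (sym (baly v)) (cong (λ z → lookup d v + deg E v * z) (sym (x≡y v)))))))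

  sink-never-fires : ∀ s → IsSink E s → ∀ c vs d → Exec E c vs d → cnt vs s ≡ 0
  sink-never-fires s s-sink c [] d done = refl
  sink-never-fires s s-sink c (v ∷ vs) d (step (v-not-sink , _) ex) with v ≟ s
  ... | yes refl = ⊥-elim (v-not-sink s-sink)
  ... | no v≢s = sink-never-fires s s-sink _ vs d ex

  chips-fire : ∀ c v → Firable E v c → sum (fire E v c) ≡ sum c
  chips-fire c v (_ , deg≤c) = +-cancelʳ-≡ (deg E v) _ _ (begin
      sum (fire E v c) + deg E v
        ≡⟨ cong (_+ deg E v) (sum-ΣT (fire E v c)) ⟩
      ΣT (lookup (fire E v c)) + deg E v
        ≡⟨ ΣT-point v (deg E v) (λ u → lookup c u + E v u) (lookup (fire E v c)) (fire-other E v c)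
             (trans (cong (_+ deg E v) (fire-self E v c)) (refill (lookup c v) (deg E v) (E v v) deg≤c)) ⟩
      ΣT (λ u → lookup c u + E v u)
        ≡⟨ ΣT-+ (lookup c) (E v) ⟩
      ΣT (lookup c) + deg E v
        ≡⟨ cong (_+ deg E v) (sym (sum-ΣT c)) ⟩
      sum c + deg E v ∎)
    where
    open ≡-Reasoning
    refill : ∀ a d e → d ≤ a → a ∸ d + e + d ≡ a + e
    refill a d e d≤a = trans (+-assoc (a ∸ d) e d) (trans (cong ((a ∸ d) +_) (+-comm e d))
                         (trans (sym (+-assoc (a ∸ d) d e)) (cong (_+ e) (m∸n+n≡m d≤a))))

  chips-exec : ∀ c vs d → Exec E c vs d → sum d ≡ sum c
  chips-exec c [] d done = refl
  chips-exec c (v ∷ vs) d (step f ex) = trans (chips-exec _ vs d ex) (chips-fire c v f)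

  chips≤total : ∀ vs c → Exec E O vs c → ∀ w → lookup c w ≤ sum O
  chips≤total vs c ex w =
    ≤-trans (ΣT-≤ (lookup c) w) (≤-reflexive (trans (sym (sum-ΣT c)) (chips-exec O vs c ex)))

argmax : ∀ {n} → Fin n → (f : Fin n → ℕ) → ∃ λ i → ∀ j → f j ≤ f i
argmax {suc zero} _ f = zero , λ { zero → ≤-refl }
argmax {suc (suc k)} _ f with argmax zero (λ i → f (suc i))
... | i , max with f zero ≤? f (suc i)
... | yes f0≤ = suc i , λ { zero → f0≤ ; (suc j) → max j }
... | no f0≰ = zero , λ { zero → ≤-refl ; (suc j) → ≤-trans (max j) (<⇒≤ (≰⇒> f0≰)) }

module ShotVectors {n} (E : Graph n) (O : Config n) (s : Fin n) (s-sink : IsSink E s)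
  (symm : ∀ v₁ v₂ → v₁ ≢ v₂ → v₁ ≢ s → v₂ ≢ s → E v₁ v₂ ≡ E v₂ v₁)
  (conn : Connected E) where

  open Balance E O

  out-edge : ∀ v w → v ≢ s → w ≢ v → Adj E v w → 0 < E v w
  out-edge v w v≢s w≢v (inj₁ v→w) = v→w
  out-edge v w v≢s w≢v (inj₂ w→v) with w ≟ s
  ... | yes refl = ⊥-elim (<-irrefl (sym (s-sink v v≢s)) w→v)
  ... | no w≢s = subst (0 <_) (symm w v w≢v w≢s v≢s) w→v

  -- A vertex cannot fire much more often than a vertex it sends chips to:
  -- those chips are held by w or were sent on by firings of w.
  shots-via-edge : ∀ vs c → Exec E O vs c → ∀ v w → 0 < E v w →
                   cnt vs v ≤ sum O + deg E w * cnt vs w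
  shots-via-edge vs c ex v w v→w = begin
      cnt vs v                          ≤⟨ m≤n*m (cnt vs v) (E v w) {{>-nonZero v→w}} ⟩
      E v w * cnt vs v                  ≤⟨ ΣT-≤ (λ u → E u w * cnt vs u) v ⟩
      received (cnt vs) w               ≤⟨ m≤n+m _ _ ⟩
      lookup O w + received (cnt vs) w  ≡⟨ sym (balanced-reach vs c ex w) ⟩
      lookup c w + deg E w * cnt vs w   ≤⟨ +-monoˡ-≤ _ (chips≤total vs c ex w) ⟩
      sum O + deg E w * cnt vs w        ∎
    where open ≤-Reasoning

  ShotBound : Fin n → Set
  ShotBound v = ∃ λ b → ∀ vs c → Exec E O vs c → cnt vs v ≤ b

  -- Induction along a path from v to the sink, which never fires.
  shot-bound : ∀ v → Star (Adj E) v s → ShotBound v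
  shot-bound v ε = 0 , λ vs c ex → ≤-reflexive (sink-never-fires s s-sink O vs c ex)
  shot-bound v (_◅_ {j = w} v—w path) with shot-bound w path | v ≟ s | w ≟ v
  ... | _ | yes refl | _ = 0 , λ vs c ex → ≤-reflexive (sink-never-fires s s-sink O vs c ex)
  ... | bound-w | no _ | yes refl = bound-w
  ... | (b , bound-w) | no v≢s | no w≢v = sum O + deg E w * b , λ vs c ex →
        ≤-trans (shots-via-edge vs c ex v w (out-edge v w v≢s w≢v v—w))
                (+-monoʳ-≤ (sum O) (*-monoʳ-≤ (deg E w) (bound-w vs c ex)))

  maxShots : ℕ
  maxShots = ΣT (λ v → proj₁ (shot-bound v (conn v s)))

  shots≤max : ∀ vs c → Exec E O vs c → ∀ v → cnt vs v ≤ maxShots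
  shots≤max vs c ex v = ≤-trans (proj₂ (shot-bound v (conn v s)) vs c ex)
                                (ΣT-≤ (λ v → proj₁ (shot-bound v (conn v s))) v)

  indeg : Fin n → ℕ
  indeg v = ΣT (λ u → E u v)

  -- By symmetry, a non-sink vertex receives from all vertices what it sends
  -- to them, except its edges to the sink.
  indeg+sink-edges : ∀ v → v ≢ s → indeg v + E v s ≡ deg E v
  indeg+sink-edges v v≢s = ΣT-point s (E v s) (E v) (λ u → E u v) sym-edge (cong (_+ E v s) (s-sink v v≢s))
    where
    sym-edge : ∀ u → u ≢ s → E u v ≡ E v u
    sym-edge u u≢s with u ≟ v
    ... | yes refl = refl
    ... | no u≢v = symm u v u≢v u≢s v≢s

  -- Two executions reaching the same configuration: the vertices where the
  -- first fired most often in excess of the second cannot exist.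
  module Excess (vs ws : List (Fin n)) (c : Config n) (exv : Exec E O vs c) (exw : Exec E O ws c) where
    x y excess : Fin n → ℕ
    x = cnt vs
    y = cnt ws
    excess u = x u ∸ y u

    module AtMaximum (M : ℕ) (excess≤ : ∀ u → excess u ≤ suc M) where
      Top : Fin n → Set
      Top v = excess v ≡ suc M

      top-shots : ∀ v → Top v → x v ≡ y v + suc M
      top-shots v top =
        trans (sym (m∸n+n≡m {x v} {y v} (<⇒≤ (m∸n≢0⇒n<m (λ e → 0≢1+n (trans (sym e) top))))))
              (trans (cong (_+ y v) top) (+-comm (suc M) (y v)))

      top-not-sink : ∀ v → Top v → v ≢ s
      top-not-sink v top refl = 0≢1+n (trans (sym (cong₂ _∸_
        (sink-never-fires s s-sink O vs c exv) (sink-never-fires s s-sink O ws c exw))) top)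

      top-received : ∀ v → Top v → received x v ≡ received y v + deg E v * suc M
      top-received v top = +-cancelˡ-≡ (lookup O v) _ _ (begin
          lookup O v + received x v                     ≡⟨ sym (balanced-reach vs c exv v) ⟩
          lookup c v + deg E v * x v                    ≡⟨ cong (λ z → lookup c v + deg E v * z) (top-shots v top) ⟩
          lookup c v + deg E v * (y v + suc M)          ≡⟨ cong (lookup c v +_) (*-distribˡ-+ (deg E v) (y v) (suc M)) ⟩
          lookup c v + (deg E v * y v + deg E v * suc M) ≡⟨ sym (+-assoc (lookup c v) _ _) ⟩
          lookup c v + deg E v * y v + deg E v * suc M  ≡⟨ cong (_+ deg E v * suc M) (balanced-reach ws c exw v) ⟩
          lookup O v + received y v + deg E v * suc M   ≡⟨ +-assoc (lookup O v) _ _ ⟩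
          lookup O v + (received y v + deg E v * suc M) ∎)
        where open ≡-Reasoning

      excess-received : ∀ v u → E u v * x u ≤ E u v * (y u + suc M)
      excess-received v u = *-monoʳ-≤ (E u v) (≤-trans (m≤n+m∸n (x u) (y u)) (+-monoʳ-≤ (y u) (excess≤ u)))

      excess-total : ∀ v → ΣT (λ u → E u v * (y u + suc M)) ≡ received y v + indeg v * suc M
      excess-total v = begin
          ΣT (λ u → E u v * (y u + suc M))
            ≡⟨ ΣT-ext _ _ (λ u → *-distribˡ-+ (E u v) (y u) (suc M)) ⟩
          ΣT (λ u → E u v * y u + E u v * suc M)
            ≡⟨ ΣT-+ (λ u → E u v * y u) (λ u → E u v * suc M) ⟩
          received y v + ΣT (λ u → E u v * suc M)
            ≡⟨ cong (received y v +_) (ΣT-ext _ _ (λ u → *-comm (E u v) (suc M))) ⟩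
          received y v + ΣT (λ u → suc M * E u v)
            ≡⟨ cong (received y v +_) (trans (ΣT-* (suc M) (λ u → E u v)) (*-comm (suc M) (indeg v))) ⟩
          received y v + indeg v * suc M ∎
        where open ≡-Reasoning

      top-no-sink-edge : ∀ v → Top v → E v s ≡ 0
      top-no-sink-edge v top = n≤0⇒n≡0 (+-cancelˡ-≤ (indeg v) _ _ (≤-trans
          (*-cancelʳ-≤ (indeg v + E v s) (indeg v) (suc M) (+-cancelˡ-≤ (received y v) _ _ squeeze))
          (≤-reflexive (sym (+-identityʳ (indeg v))))))
        where
        open ≤-Reasoning
        squeeze : received y v + (indeg v + E v s) * suc M ≤ received y v + indeg v * suc M
        squeeze = begin
          received y v + (indeg v + E v s) * suc M
            ≡⟨ cong (λ z → received y v + z * suc M) (indeg+sink-edges v (top-not-sink v top)) ⟩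
          received y v + deg E v * suc M      ≡⟨ sym (top-received v top) ⟩
          received x v                        ≤⟨ ΣT-mono _ _ (excess-received v) ⟩
          ΣT (λ u → E u v * (y u + suc M))    ≡⟨ excess-total v ⟩
          received y v + indeg v * suc M      ∎

      top-closed : ∀ v → Top v → ∀ u → 0 < E u v → Top u
      top-closed v top u u→v = trans (cong (_∸ y u) x-at-u) (m+n∸m≡n (y u) (suc M))
        where
        no-sink-edge : deg E v ≡ indeg v
        no-sink-edge = trans (sym (indeg+sink-edges v (top-not-sink v top)))
                             (trans (cong (indeg v +_) (top-no-sink-edge v top)) (+-identityʳ _))
        tight : received x v ≡ ΣT (λ u → E u v * (y u + suc M))
        tight = trans (top-received v top)
                  (trans (cong (λ z → received y v + z * suc M) no-sink-edge) (sym (excess-total v)))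
        x-at-u : x u ≡ y u + suc M
        x-at-u = *-cancelˡ-≡ (x u) (y u + suc M) (E u v) {{>-nonZero u→v}}
                   (ΣT-equal _ _ (excess-received v) tight u)

      -- Following a path to the sink stays among top vertices, which is absurd.
      no-top : ∀ v → Star (Adj E) v s → Top v → ⊥
      no-top v ε top = top-not-sink v top refl
      no-top v (_◅_ {j = w} v—w path) top with w ≟ s | w ≟ v
      ... | yes refl | _ = sink-edge v—w
        where
        v≢s = top-not-sink v top
        sink-edge : Adj E v s → ⊥
        sink-edge (inj₁ v→s) = <-irrefl (sym (top-no-sink-edge v top)) v→s
        sink-edge (inj₂ s→v) = <-irrefl (sym (s-sink v v≢s)) s→v
      ... | no _ | yes refl = no-top w path top
      ... | no w≢s | no w≢v = no-top w path (top-closed v top w (in-edge v—w))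
        where
        v≢s = top-not-sink v top
        in-edge : Adj E v w → 0 < E w v
        in-edge (inj₂ w→v) = w→v
        in-edge (inj₁ v→w) = subst (0 <_) (symm v w (λ e → w≢v (sym e)) v≢s w≢s) v→w

    shots-≤ : ∀ v → x v ≤ y v
    shots-≤ v with argmax s excess
    ... | i , max with excess i in top
    ... | zero = m∸n≡0⇒m≤n (n≤0⇒n≡0 (max v))
    ... | suc M = ⊥-elim (AtMaximum.no-top M max i (conn i s) top)

  shots-unique : ∀ vs ws c → Exec E O vs c → Exec E O ws c → ∀ v → cnt vs v ≡ cnt ws v
  shots-unique vs ws c exv exw v = ≤-antisym (Excess.shots-≤ vs ws c exv exw v) (Excess.shots-≤ ws vs c exw exv v)

∸≤⇒≤+ : ∀ m n o → m ∸ n ≤ o → m ≤ n + o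
∸≤⇒≤+ m n o h = ≤-trans (m≤n+m∸n m n) (+-monoʳ-≤ n h)

-- A cell with degree D and threshold t ≤ D holds D ∸ t + q chips while
-- unfired; it is firable iff t ≤ q, and firing leaves q ∸ t.
unfired-fire : ∀ D t q → t ≤ D → ((D ∸ t) + q) ∸ D ≡ q ∸ t
unfired-fire D t q t≤D = begin
  ((D ∸ t) + q) ∸ D ≡⟨ cong (_∸ D) (sym (+-∸-comm q t≤D)) ⟩
  ((D + q) ∸ t) ∸ D ≡⟨ ∸-+-assoc (D + q) t D ⟩
  (D + q) ∸ (t + D) ≡⟨ cong ((D + q) ∸_) (+-comm t D) ⟩
  (D + q) ∸ (D + t) ≡⟨ [m+n]∸[m+o]≡n∸o D q t ⟩
  q ∸ t             ∎
  where open ≡-Reasoning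

unfired-firable⇒met : ∀ D t q → t ≤ D → D ≤ (D ∸ t) + q → t ≤ q
unfired-firable⇒met D t q t≤D firable = +-cancelˡ-≤ (D ∸ t) t q
  (≤-trans (≤-reflexive (trans (+-comm (D ∸ t) t) (trans (sym (+-∸-assoc t t≤D)) (m+n∸m≡n t D)))) firable)

met⇒unfired-firable : ∀ D t q → t ≤ D → t ≤ q → D ≤ (D ∸ t) + q
met⇒unfired-firable D t q t≤D t≤q = ≤-trans (≤-reflexive (sym (m∸n+n≡m t≤D))) (+-monoʳ-≤ (D ∸ t) t≤q)

-- Arithmetic of the gadget replacing a vertex u by a path of copies, where
-- B is a weight exceeding everything u can receive from other vertices.
-- The firing condition of u (degree d, o initial chips, e loops) is
-- rewritten as a condition on the chips R received from the other vertices: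
-- copy k of u, standing for the (k+1)-st firing, must receive threshold k
-- chips, plus B from copy k-1 when k > 0.
module CopyArithmetic (B : ℕ) where

  threshold : (d o e k : ℕ) → ℕ
  threshold d o e zero = d ∸ o
  threshold d o e (suc k) = B + (d * suc (suc k) ∸ (o + e * suc k))

  predBonus : ℕ → ℕ
  predBonus zero = 0
  predBonus (suc _) = B

  -- After k firings (c + d k = o + e k + R), u is firable iff copy k's threshold is met.
  firable⇒threshold : ∀ d o e R c k → c + d * k ≡ o + (e * k + R) → d ≤ c →
                      threshold d o e k ≤ R + predBonus k
  firable⇒threshold d o e R c zero bal d≤c =
    m≤n+o⇒m∸n≤o d o (≤-trans d≤c (≤-reflexive (begin
      c                  ≡⟨ sym (+-identityʳ c) ⟩
      c + 0              ≡⟨ cong (c +_) (sym (*-zeroʳ d)) ⟩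
      c + d * 0          ≡⟨ bal ⟩
      o + (e * 0 + R)    ≡⟨ cong (λ z → o + (z + R)) (*-zeroʳ e) ⟩
      o + R              ≡⟨ cong (o +_) (sym (+-identityʳ R)) ⟩
      o + (R + 0)        ∎)))
    where open ≡-Reasoning
  firable⇒threshold d o e R c (suc k) bal d≤c =
    ≤-trans (≤-reflexive (+-comm B _)) (+-monoˡ-≤ B (m≤n+o⇒m∸n≤o _ _ (≤-trans one-more (≤-reflexive regroup))))
    where
    one-more : d * suc (suc k) ≤ c + d * suc k
    one-more = ≤-trans (≤-reflexive (*-comm d (suc (suc k))))
                 (≤-trans (+-monoˡ-≤ _ d≤c) (≤-reflexive (cong (c +_) (*-comm (suc k) d))))
    regroup : c + d * suc k ≡ o + e * suc k + R
    regroup = trans bal (sym (+-assoc o _ R))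

  threshold⇒firable : ∀ d o e R c k → c + d * k ≡ o + (e * k + R) →
                      threshold d o e k ≤ R + predBonus k → d ≤ c
  threshold⇒firable d o e R c zero bal met =
    ≤-trans (∸≤⇒≤+ d o R (≤-trans met (≤-reflexive (+-identityʳ R)))) (≤-reflexive (begin
      o + R              ≡⟨ cong (λ z → o + (z + R)) (sym (*-zeroʳ e)) ⟩
      o + (e * 0 + R)    ≡⟨ sym bal ⟩
      c + d * 0          ≡⟨ cong (c +_) (*-zeroʳ d) ⟩
      c + 0              ≡⟨ +-identityʳ c ⟩
      c                  ∎))
    where open ≡-Reasoning
  threshold⇒firable d o e R c (suc k) bal met =
    +-cancelʳ-≤ (d * suc k) d c
      (≤-trans (≤-reflexive (one-more d k)) (≤-trans enough (≤-reflexive (sym (trans bal (sym (+-assoc o _ R)))))))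
    where
    enough : d * suc (suc k) ≤ o + e * suc k + R
    enough = ∸≤⇒≤+ _ _ R (+-cancelʳ-≤ B _ R (≤-trans (≤-reflexive (+-comm _ B)) met))
    one-more : ∀ d k → d + d * suc k ≡ d * suc (suc k)
    one-more = solve-∀

  fired⇒threshold : ∀ d o e R c x j → j < x → e ≤ c → e ≤ d → c + d * x ≡ o + (e * x + R) →
                    threshold d o e j ≤ R + predBonus j
  fired⇒threshold d o e R c x j j<x e≤c e≤d bal = from-key j key
    where
    t : ℕ
    t = x ∸ suc j
    x≡ : x ≡ suc j + t
    x≡ = sym (m+[n∸m]≡n j<x)
    key : d * suc j ≤ o + e * j + R
    key = +-cancelˡ-≤ (e + e * t) _ _ (begin
        e + e * t + d * suc j     ≤⟨ +-monoˡ-≤ (d * suc j) (+-monoʳ-≤ e (*-monoˡ-≤ t e≤d)) ⟩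
        e + d * t + d * suc j     ≡⟨ regroupˡ e d t j ⟩
        e + d * (suc j + t)       ≡⟨ cong (λ z → e + d * z) (sym x≡) ⟩
        e + d * x                 ≤⟨ +-monoˡ-≤ (d * x) e≤c ⟩
        c + d * x                 ≡⟨ bal ⟩
        o + (e * x + R)           ≡⟨ cong (λ z → o + (e * z + R)) x≡ ⟩
        o + (e * (suc j + t) + R) ≡⟨ regroupʳ o e j t R ⟩
        e + e * t + (o + e * j + R) ∎)
      where
      open ≤-Reasoning
      regroupˡ : ∀ e d t j → e + d * t + d * suc j ≡ e + d * (suc j + t)
      regroupˡ = solve-∀
      regroupʳ : ∀ o e j t R → o + (e * (suc j + t) + R) ≡ e + e * t + (o + e * j + R)
      regroupʳ = solve-∀
    from-key : ∀ j → d * suc j ≤ o + e * j + R → threshold d o e j ≤ R + predBonus j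
    from-key zero h = ≤-trans
      (m≤n+o⇒m∸n≤o d o (≤-trans (≤-reflexive (sym (*-identityʳ d)))
        (≤-trans h (≤-reflexive (cong (_+ R) (trans (cong (o +_) (*-zeroʳ e)) (+-identityʳ o)))))))
      (≤-reflexive (sym (+-identityʳ R)))
    from-key (suc k) h = ≤-trans (≤-reflexive (+-comm B _)) (+-monoˡ-≤ B (m≤n+o⇒m∸n≤o _ _ h))

  -- Path weights: consecutive copies are joined by B edges.  below t a and
  -- same t a are B if t < a, resp. t ≡ a, and 0 otherwise.
  below : ℕ → ℕ → ℕ
  below t zero = 0
  below zero (suc a) = B
  below (suc t) (suc a) = below t a

  same : ℕ → ℕ → ℕ
  same zero zero = B
  same zero (suc a) = 0
  same (suc t) zero = 0
  same (suc t) (suc a) = same t a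

  -- Chips copy j has received from copy j-1, resp. copy j+1, once a copies fired.
  fromPred : ℕ → ℕ → ℕ
  fromPred zero a = 0
  fromPred (suc k) a = below k a

  fromSucc : ℕ → ℕ → ℕ
  fromSucc j a = below (suc j) a

  -- Copies a and j are joined by B edges iff they are adjacent on the path.
  pathW : ℕ → ℕ → ℕ
  pathW a j = same j (suc a) + same (suc j) a

  below-suc : ∀ t a → below t (suc a) ≡ below t a + same t a
  below-suc zero zero = refl
  below-suc zero (suc a) = sym (+-identityʳ B)
  below-suc (suc t) zero = refl
  below-suc (suc t) (suc a) = below-suc t a

  below-< : ∀ t a → t < a → below t a ≡ B
  below-< zero (suc a) _ = refl
  below-< (suc t) (suc a) (s≤s t<a) = below-< t a t<a

  below-≥ : ∀ t a → a ≤ t → below t a ≡ 0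
  below-≥ t zero _ = refl
  below-≥ (suc t) (suc a) (s≤s a≤t) = below-≥ t a a≤t

  below≤B : ∀ t a → below t a ≤ B
  below≤B t zero = z≤n
  below≤B zero (suc a) = ≤-refl
  below≤B (suc t) (suc a) = below≤B t a

  same-sym : ∀ t a → same t a ≡ same a t
  same-sym zero zero = refl
  same-sym zero (suc a) = refl
  same-sym (suc t) zero = refl
  same-sym (suc t) (suc a) = same-sym t a

  same-suc : ∀ a → same a (suc a) ≡ 0
  same-suc zero = refl
  same-suc (suc a) = same-suc a

  path-step : ∀ j a → fromPred j (suc a) + fromSucc j (suc a) ≡ fromPred j a + fromSucc j a + pathW a j
  path-step zero a = below-suc 1 a
  path-step (suc k) a =
    trans (cong₂ _+_ (below-suc k a) (below-suc (suc (suc k)) a)) (swap-middle (below k a) _ _ _)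
    where
    swap-middle : ∀ p q r t → p + q + (r + t) ≡ p + r + (q + t)
    swap-middle = solve-∀

  pathW-self : ∀ a → pathW a a ≡ 0
  pathW-self a = cong₂ _+_ (same-suc a) (trans (same-sym (suc a) a) (same-suc a))

  pathW-sym : ∀ a b → pathW a b ≡ pathW b a
  pathW-sym a b = trans (cong₂ _+_ (same-sym b (suc a)) (same-sym (suc b) a)) (+-comm (same (suc a) b) (same a (suc b)))

  fromPred≤B : ∀ j a → fromPred j a ≤ B
  fromPred≤B zero a = z≤n
  fromPred≤B (suc k) a = below≤B k a

  fromPred-self : ∀ a → fromPred a a ≡ predBonus a
  fromPred-self zero = refl
  fromPred-self (suc k) = below-< k (suc k) ≤-refl

  fromSucc-self : ∀ a → fromSucc a a ≡ 0
  fromSucc-self a = below-≥ (suc a) a (n≤1+n a)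

  fromPred-fired : ∀ j a → j < a → fromPred j a ≡ predBonus j
  fromPred-fired zero a _ = refl
  fromPred-fired (suc k) a k<a = below-< k a (<-trans (n<1+n k) k<a)

  fromPred-unfired : ∀ j a → a < j → fromPred j a ≡ 0
  fromPred-unfired (suc k) a (s≤s a≤k) = below-≥ k a a≤k

  fromSucc-unfired : ∀ j a → a < j → fromSucc j a ≡ 0
  fromSucc-unfired j a a<j = below-≥ (suc j) a (≤-trans (<⇒≤ a<j) (n≤1+n j))

module SimpleModel {n} (E : Graph n) (O : Config n) (s : Fin n) (s-sink : IsSink E s)
  (symm : ∀ v₁ v₂ → v₁ ≢ v₂ → v₁ ≢ s → v₂ ≢ s → E v₁ v₂ ≡ E v₂ v₁)
  (conn : Connected E) (uniq : ∀ v → IsSink E v → v ≡ s) where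

  open Balance E O
  open ShotVectors E O s s-sink symm conn

  degSum : ℕ
  degSum = ΣT (deg E)

  -- B exceeds every amount of chips a vertex receives in a reachable configuration.
  B : ℕ
  B = suc (sum O + degSum * maxShots)

  open CopyArithmetic B

  -- Vertices of E' are cells (u , j): copy j of u for u ≢ s; the cells
  -- (s , 0) and (s , k+1) are the sink and isolated leaves hanging on it.
  -- j ranges over 0 .. maxShots, one copy per possible firing.
  copies : ℕ
  copies = suc maxShots

  m : ℕ
  m = n * copies

  Cell : Set
  Cell = Fin n × Fin copies

  decode : Fin m → Cell
  decode = remQuot copies

  encode : Cell → Fin m
  encode (u , j) = combine u j

  sinkCell : Cell
  sinkCell = s , zero

  sink' : Fin m
  sink' = encode sinkCell

  -- Chips copy j of u must receive from other cells before it can fire.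
  T : Fin n → ℕ → ℕ
  T u j = threshold (deg E u) (lookup O u) (E u u) j

  -- Edges from copy j of u to the sink: more than 3B + T u j, so a fired
  -- copy (holding at most 3B chips) can never fire again.
  W : Fin n → ℕ → ℕ
  W u j = suc (B + B + B + T u j)

  leafRow : Fin copies → Cell → ℕ
  leafRow zero _ = 0
  leafRow (suc _) (v , i) with v ≟ s
  ... | no _ = 0
  ... | yes _ = isZero i
    where
    isZero : Fin copies → ℕ
    isZero zero = 1
    isZero (suc _) = 0

  toSinkColumn : Fin n → Fin copies → Fin copies → ℕ
  toSinkColumn u j zero = W u (toℕ j)
  toSinkColumn u j (suc _) = 0

  E₂ : Cell → Cell → ℕ
  E₂ (u , j) (v , i) with u ≟ s
  ... | yes _ = leafRow j (v , i)
  ... | no _ with v ≟ s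
  ...   | yes _ = toSinkColumn u j i
  ...   | no _ with u ≟ v
  ...     | yes _ = pathW (toℕ j) (toℕ i)
  ...     | no _ = E u v

  E' : Graph m
  E' a b = E₂ (decode a) (decode b)

  deg' : Cell → ℕ
  deg' p = deg E' (encode p)

  edgeInto : Fin n → Fin n → ℕ
  edgeInto u w with w ≟ u
  ... | yes _ = 0
  ... | no _ = E w u

  fromOthers : Fin n → (Fin n → ℕ) → ℕ
  fromOthers u x = ΣT (λ w → edgeInto u w * x w)

  -- Chips received by copy j of u once the cells of shot vector x fired.
  incoming : (Fin n → ℕ) → Fin n → ℕ → ℕ
  incoming x u j = fromOthers u x + fromPred j (x u) + fromSucc j (x u)

  sinkGain : Fin n → ℕ → ℕ
  sinkGain v zero = 0
  sinkGain v (suc k) = sinkGain v k + W v k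

  sinkChips : (Fin n → ℕ) → ℕ
  sinkChips x = ΣT (λ v → sinkGain v (x v))

  -- A copy with degree D, threshold t and q received chips: if fired, it
  -- holds q ∸ t, otherwise D ∸ t + q.
  cellValue : ∀ {A : Set} → ℕ → ℕ → ℕ → Dec A → ℕ
  cellValue D t q (yes _) = q ∸ t
  cellValue D t q (no _) = (D ∸ t) + q

  sinkColumn : (Fin n → ℕ) → Fin copies → ℕ
  sinkColumn x zero = sinkChips x
  sinkColumn x (suc _) = 0

  cellChips : (Fin n → ℕ) → Cell → ℕ
  cellChips x (u , j) with u ≟ s
  ... | yes _ = sinkColumn x j
  ... | no _ = cellValue (deg' (u , j)) (T u (toℕ j)) (incoming x u (toℕ j)) (toℕ j <? x u)

  image : (Fin n → ℕ) → Config m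
  image x = tabulate (λ w → cellChips x (decode w))

  O' : Config m
  O' = image (λ _ → 0)

  decode-encode : ∀ p → decode (encode p) ≡ p
  decode-encode (u , j) = remQuot-combine u j

  encode-decode : ∀ w → encode (decode w) ≡ w
  encode-decode w = combine-remQuot {n} copies w

  encode-injective : ∀ p q → encode p ≡ encode q → p ≡ q
  encode-injective p q e = trans (sym (decode-encode p)) (trans (cong decode e) (decode-encode q))

  lookup-image : ∀ x p → lookup (image x) (encode p) ≡ cellChips x p
  lookup-image x p = trans (lookup∘tabulate _ (encode p)) (cong (cellChips x) (decode-encode p))

  E'-encode : ∀ p q → E' (encode p) (encode q) ≡ E₂ p q
  E'-encode p q = cong₂ E₂ (decode-encode p) (decode-encode q)

  E₂≤deg' : ∀ p q → E₂ p q ≤ deg' p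
  E₂≤deg' p q = ≤-trans (≤-reflexive (sym (E'-encode p q))) (ΣT-≤ (E' (encode p)) (encode q))

  E₂-toSink : ∀ u j → u ≢ s → E₂ (u , j) sinkCell ≡ W u (toℕ j)
  E₂-toSink u j u≢s with u ≟ s
  ... | yes u≡s = ⊥-elim (u≢s u≡s)
  ... | no _ with s ≟ s
  ...   | yes _ = refl
  ...   | no s≢s = ⊥-elim (s≢s refl)

  E₂-toLeaf : ∀ u j k → u ≢ s → E₂ (u , j) (s , suc k) ≡ 0
  E₂-toLeaf u j k u≢s with u ≟ s
  ... | yes u≡s = ⊥-elim (u≢s u≡s)
  ... | no _ with s ≟ s
  ...   | yes _ = refl
  ...   | no s≢s = ⊥-elim (s≢s refl)

  E₂-path : ∀ u i j → u ≢ s → E₂ (u , i) (u , j) ≡ pathW (toℕ i) (toℕ j)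
  E₂-path u i j u≢s with u ≟ s
  ... | yes u≡s = ⊥-elim (u≢s u≡s)
  ... | no _ with u ≟ s
  ...   | yes u≡s = ⊥-elim (u≢s u≡s)
  ...   | no _ with u ≟ u
  ...     | yes _ = refl
  ...     | no u≢u = ⊥-elim (u≢u refl)

  E₂-other : ∀ u i v j → u ≢ s → v ≢ s → u ≢ v → E₂ (u , i) (v , j) ≡ E u v
  E₂-other u i v j u≢s v≢s u≢v with u ≟ s
  ... | yes u≡s = ⊥-elim (u≢s u≡s)
  ... | no _ with v ≟ s
  ...   | yes v≡s = ⊥-elim (v≢s v≡s)
  ...   | no _ with u ≟ v
  ...     | yes u≡v = ⊥-elim (u≢v u≡v)
  ...     | no _ = refl

  E₂-fromSinkColumn : ∀ j q → E₂ (s , j) q ≡ leafRow j q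
  E₂-fromSinkColumn j q with s ≟ s
  ... | yes _ = refl
  ... | no s≢s = ⊥-elim (s≢s refl)

  leaf-to-sink : ∀ k → E₂ (s , suc k) sinkCell ≡ 1
  leaf-to-sink k = trans (E₂-fromSinkColumn (suc k) sinkCell) leafRow-sink
    where
    leafRow-sink : leafRow (suc k) sinkCell ≡ 1
    leafRow-sink with s ≟ s
    ... | yes _ = refl
    ... | no s≢s = ⊥-elim (s≢s refl)

  W≤deg' : ∀ u j → u ≢ s → W u (toℕ j) ≤ deg' (u , j)
  W≤deg' u j u≢s = ≤-trans (≤-reflexive (sym (E₂-toSink u j u≢s))) (E₂≤deg' (u , j) sinkCell)

  T≤deg' : ∀ u j → u ≢ s → T u (toℕ j) ≤ deg' (u , j)
  T≤deg' u j u≢s = ≤-trans (m≤n+m (T u (toℕ j)) (B + B + B)) (≤-trans (n≤1+n _) (W≤deg' u j u≢s))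

  cellValue-yes : ∀ {A : Set} D t q (d : Dec A) → A → cellValue D t q d ≡ q ∸ t
  cellValue-yes D t q (yes _) a = refl
  cellValue-yes D t q (no ¬a) a = ⊥-elim (¬a a)

  cellValue-no : ∀ {A : Set} D t q (d : Dec A) → ¬ A → cellValue D t q d ≡ (D ∸ t) + q
  cellValue-no D t q (yes a) ¬a = ⊥-elim (¬a a)
  cellValue-no D t q (no _) ¬a = refl

  cellValue-cong : ∀ {A A' : Set} D t q q' (d : Dec A) (d' : Dec A') →
                   q ≡ q' → (A → A') → (A' → A) → cellValue D t q d ≡ cellValue D t q' d'
  cellValue-cong D t q q' (yes a) (yes a') e f g = cong (_∸ t) e
  cellValue-cong D t q q' (yes a) (no ¬a') e f g = ⊥-elim (¬a' (f a))
  cellValue-cong D t q q' (no ¬a) (yes a') e f g = ⊥-elim (¬a (g a'))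
  cellValue-cong D t q q' (no ¬a) (no ¬a') e f g = cong ((D ∸ t) +_) e

  cellValue-receive : ∀ {A A' : Set} D t q a (d : Dec A) (d' : Dec A') → (A → A') → (A' → A) →
                      (A → t ≤ q) → cellValue D t q d + a ≡ cellValue D t (q + a) d'
  cellValue-receive D t q a (yes p) (yes p') f g met = sym (+-∸-comm a (met p))
  cellValue-receive D t q a (yes p) (no ¬p') f g met = ⊥-elim (¬p' (f p))
  cellValue-receive D t q a (no ¬p) (yes p') f g met = ⊥-elim (¬p (g p'))
  cellValue-receive D t q a (no ¬p) (no ¬p') f g met = +-assoc (D ∸ t) q a

  cellChips-copy : ∀ x u j → u ≢ s →
    cellChips x (u , j) ≡ cellValue (deg' (u , j)) (T u (toℕ j)) (incoming x u (toℕ j)) (toℕ j <? x u)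
  cellChips-copy x u j u≢s with u ≟ s
  ... | yes u≡s = ⊥-elim (u≢s u≡s)
  ... | no _ = refl

  cellChips-sinkColumn : ∀ x j → cellChips x (s , j) ≡ sinkColumn x j
  cellChips-sinkColumn x j with s ≟ s
  ... | yes _ = refl
  ... | no s≢s = ⊥-elim (s≢s refl)

  cellChips-unfired : ∀ x u j → u ≢ s → toℕ j ≡ x u →
    cellChips x (u , j) ≡ (deg' (u , j) ∸ T u (toℕ j)) + incoming x u (toℕ j)
  cellChips-unfired x u j u≢s j≡ =
    trans (cellChips-copy x u j u≢s) (cellValue-no _ _ _ (toℕ j <? x u) (λ j< → <-irrefl j≡ j<))

  edgeInto-self : ∀ u → edgeInto u u ≡ 0
  edgeInto-self u with u ≟ u
  ... | yes _ = refl
  ... | no u≢u = ⊥-elim (u≢u refl)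

  edgeInto-other : ∀ u w → u ≢ w → edgeInto u w ≡ E w u
  edgeInto-other u w u≢w with w ≟ u
  ... | yes w≡u = ⊥-elim (u≢w (sym w≡u))
  ... | no _ = refl

  fromOthers-cong : ∀ x y → (∀ w → x w ≡ y w) → ∀ u → fromOthers u x ≡ fromOthers u y
  fromOthers-cong x y x≡y u = ΣT-ext _ _ (λ w → cong (edgeInto u w *_) (x≡y w))

  image-cong : ∀ x y → (∀ w → x w ≡ y w) → image x ≡ image y
  image-cong x y x≡y = tabulate-cong (λ w → at (decode w))
    where
    at : ∀ p → cellChips x p ≡ cellChips y p
    at (u , j) with u ≟ s
    at (u , zero) | yes _ = ΣT-ext _ _ (λ w → cong (sinkGain w) (x≡y w))
    at (u , suc _) | yes _ = refl
    ... | no _ = cellValue-cong _ _ _ _ (toℕ j <? x u) (toℕ j <? y u)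
                   (cong₂ _+_ (cong₂ _+_ (fromOthers-cong x y x≡y u) (cong (fromPred (toℕ j)) (x≡y u)))
                              (cong (fromSucc (toℕ j)) (x≡y u)))
                   (subst (toℕ j <_) (x≡y u)) (subst (toℕ j <_) (sym (x≡y u)))

  loops-kept : ∀ x c vs d → (∀ u → 0 < x u → E u u ≤ lookup c u) → Exec E c vs d →
               ∀ u → 0 < x u + cnt vs u → E u u ≤ lookup d u
  loops-kept x c [] d kept done u fired = kept u (subst (0 <_) (+-identityʳ (x u)) fired)
  loops-kept x c (v ∷ vs) d kept (step f ex) u fired =
    loops-kept (bump x v) (fire E v c) vs d kept' ex u
      (subst (0 <_) (sym (+-assoc (x u) (δ v u) (cnt vs u))) fired)
    where
    kept' : ∀ w → 0 < bump x v w → E w w ≤ lookup (fire E v c) w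
    kept' w fired-w with w ≟ v
    ... | yes refl = ≤-trans (m≤n+m (E v v) _) (≤-reflexive (sym (fire-self E v c)))
    ... | no w≢v = ≤-trans (kept w (subst (0 <_) (bump-other x v w w≢v) fired-w))
                    (≤-trans (m≤m+n _ _) (≤-reflexive (sym (fire-other E v c w w≢v))))

  loops-kept-reach : ∀ vs c → Exec E O vs c → ∀ u → 0 < cnt vs u → E u u ≤ lookup c u
  loops-kept-reach vs c ex u fired = loops-kept (λ _ → 0) O vs c (λ u ()) ex u fired

  received-split : ∀ x u → received x u ≡ E u u * x u + fromOthers u x
  received-split x u =
    trans (sym (ΣT-point u (E u u * x u) (λ w → E w u * x w) (λ w → edgeInto u w * x w)
                 (λ w w≢u → cong (_* x w) (edgeInto-other u w (λ e → w≢u (sym e))))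
                 (cong (λ z → z * x u + E u u * x u) (edgeInto-self u))))
          (+-comm (fromOthers u x) _)

  balanced-loops : ∀ vs c → Exec E O vs c → ∀ u →
    lookup c u + deg E u * cnt vs u ≡ lookup O u + (E u u * cnt vs u + fromOthers u (cnt vs))
  balanced-loops vs c ex u = trans (balanced-reach vs c ex u) (cong (lookup O u +_) (received-split (cnt vs) u))

  fromOthers<B : ∀ vs c → Exec E O vs c → ∀ u → fromOthers u (cnt vs) < B
  fromOthers<B vs c ex u = s≤s (begin
      fromOthers u (cnt vs)                             ≤⟨ m≤n+m _ _ ⟩
      E u u * cnt vs u + fromOthers u (cnt vs)          ≡⟨ sym (received-split (cnt vs) u) ⟩
      received (cnt vs) u                               ≤⟨ m≤n+m _ _ ⟩
      lookup O u + received (cnt vs) u                  ≡⟨ sym (balanced-reach vs c ex u) ⟩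
      lookup c u + deg E u * cnt vs u                   ≤⟨ +-mono-≤ (chips≤total vs c ex u)
                                                             (*-mono-≤ (ΣT-≤ (deg E) u) (shots≤max vs c ex u)) ⟩
      sum O + degSum * maxShots                         ∎)
    where open ≤-Reasoning

  incoming≤3B : ∀ vs c → Exec E O vs c → ∀ u j → incoming (cnt vs) u j ≤ B + B + B
  incoming≤3B vs c ex u j =
    +-mono-≤ (+-mono-≤ (<⇒≤ (fromOthers<B vs c ex u)) (fromPred≤B j (cnt vs u))) (below≤B (suc j) (cnt vs u))

  fired-met : ∀ vs c → Exec E O vs c → ∀ u j → j < cnt vs u → T u j ≤ incoming (cnt vs) u j
  fired-met vs c ex u j j<x = ≤-trans
     (fired⇒threshold (deg E u) (lookup O u) (E u u) (fromOthers u (cnt vs)) (lookup c u) (cnt vs u) j j<x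
          (loops-kept-reach vs c ex u (≤-trans (s≤s z≤n) j<x)) (ΣT-≤ (E u) u) (balanced-loops vs c ex u))
     (≤-trans (≤-reflexive (cong (fromOthers u (cnt vs) +_) (sym (fromPred-fired j (cnt vs u) j<x)))) (m≤m+n _ _))

  incoming-next : ∀ x u → incoming x u (x u) ≡ fromOthers u x + predBonus (x u)
  incoming-next x u = trans (cong₂ (λ a b → fromOthers u x + a + b) (fromPred-self (x u)) (fromSucc-self (x u)))
                            (+-identityʳ _)

  firable⇒next-met : ∀ vs c → Exec E O vs c → ∀ u → deg E u ≤ lookup c u →
                     T u (cnt vs u) ≤ incoming (cnt vs) u (cnt vs u)
  firable⇒next-met vs c ex u deg≤c = ≤-trans
    (firable⇒threshold (deg E u) (lookup O u) (E u u) (fromOthers u (cnt vs)) (lookup c u) (cnt vs u)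
       (balanced-loops vs c ex u) deg≤c)
    (≤-reflexive (sym (incoming-next (cnt vs) u)))

  next-met⇒firable : ∀ vs c → Exec E O vs c → ∀ u → T u (cnt vs u) ≤ incoming (cnt vs) u (cnt vs u) →
                     deg E u ≤ lookup c u
  next-met⇒firable vs c ex u met =
    threshold⇒firable (deg E u) (lookup O u) (E u u) (fromOthers u (cnt vs)) (lookup c u) (cnt vs u)
      (balanced-loops vs c ex u) (≤-trans met (≤-reflexive (incoming-next (cnt vs) u)))

  -- The next copy of u exists, since u fires at most maxShots times.
  nextCopy : ∀ vs c → Exec E O vs c → ∀ v → Σ (Fin copies) λ i → toℕ i ≡ cnt vs v
  nextCopy vs c ex v = fromℕ< (s≤s (shots≤max vs c ex v)) , toℕ-fromℕ< _

  module OneMore (x : Fin n → ℕ) (v : Fin n) where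
    y : Fin n → ℕ
    y = bump x v

    fromOthers-other : ∀ u → u ≢ v → fromOthers u y ≡ fromOthers u x + E v u
    fromOthers-other u u≢v =
      trans (ΣT-bump (edgeInto u) x v) (cong (fromOthers u x +_) (edgeInto-other u v u≢v))

    fromOthers-self : fromOthers v y ≡ fromOthers v x
    fromOthers-self =
      trans (ΣT-bump (edgeInto v) x v) (trans (cong (fromOthers v x +_) (edgeInto-self v)) (+-identityʳ _))

    sinkChips-step : sinkChips y ≡ sinkChips x + W v (x v)
    sinkChips-step = sym (ΣT-point v (W v (x v)) (λ w → sinkGain w (y w)) (λ w → sinkGain w (x w))
                       (λ w w≢v → cong (sinkGain w) (sym (bump-other x v w w≢v))) (cong (sinkGain v) (sym (bump-self x v))))

    incoming-self : ∀ j → incoming y v j ≡ incoming x v j + pathW (x v) j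
    incoming-self j = begin
      fromOthers v y + fromPred j (y v) + fromSucc j (y v)
        ≡⟨ cong₂ (λ a b → a + fromPred j b + fromSucc j b) fromOthers-self (bump-self x v) ⟩
      fromOthers v x + fromPred j (suc (x v)) + fromSucc j (suc (x v))
        ≡⟨ +-assoc (fromOthers v x) _ _ ⟩
      fromOthers v x + (fromPred j (suc (x v)) + fromSucc j (suc (x v)))
        ≡⟨ cong (fromOthers v x +_) (path-step j (x v)) ⟩
      fromOthers v x + (fromPred j (x v) + fromSucc j (x v) + pathW (x v) j)
        ≡⟨ regroup (fromOthers v x) _ _ _ ⟩
      fromOthers v x + fromPred j (x v) + fromSucc j (x v) + pathW (x v) j ∎
      where
      open ≡-Reasoning
      regroup : ∀ a b c d → a + (b + c + d) ≡ a + b + c + d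
      regroup = solve-∀

    incoming-other : ∀ u j → u ≢ v → incoming y u j ≡ incoming x u j + E v u
    incoming-other u j u≢v = begin
      fromOthers u y + fromPred j (y u) + fromSucc j (y u)
        ≡⟨ cong₂ (λ a b → a + fromPred j b + fromSucc j b) (fromOthers-other u u≢v) (bump-other x v u u≢v) ⟩
      fromOthers u x + E v u + fromPred j (x u) + fromSucc j (x u)
        ≡⟨ regroup (fromOthers u x) (E v u) _ _ ⟩
      fromOthers u x + fromPred j (x u) + fromSucc j (x u) + E v u ∎
      where
      open ≡-Reasoning
      regroup : ∀ a b c d → a + b + c + d ≡ a + c + d + b
      regroup = solve-∀

  firable-not-sink : ∀ v c → Firable E v c → v ≢ s
  firable-not-sink v c (not-sink , _) refl = not-sink s-sink

  module FireCopy (vs : List (Fin n)) (c : Config n) (ex : Exec E O vs c) (v : Fin n) (f : Firable E v c)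
                  (i : Fin copies) (i≡ : toℕ i ≡ cnt vs v) where
    x : Fin n → ℕ
    x = cnt vs
    open OneMore x v

    z : Fin m
    z = encode (v , i)

    v≢s : v ≢ s
    v≢s = firable-not-sink v c f

    x<y : toℕ i < y v
    x<y = subst (toℕ i <_) (sym (bump-self x v)) (subst (_< suc (x v)) (sym i≡) ≤-refl)

    -- The fired copy keeps what it had beyond its degree (it has no loop).
    after-self : lookup (fire E' z (image x)) z ≡ cellChips y (v , i)
    after-self = begin
      lookup (fire E' z (image x)) z
        ≡⟨ fire-self E' z (image x) ⟩
      (lookup (image x) z ∸ deg' (v , i)) + E' z z
        ≡⟨ cong₂ (λ a b → (a ∸ deg' (v , i)) + b) (lookup-image x (v , i))
                 (trans (E'-encode (v , i) (v , i)) (trans (E₂-path v i i v≢s) (pathW-self (toℕ i)))) ⟩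
      (cellChips x (v , i) ∸ deg' (v , i)) + 0
        ≡⟨ +-identityʳ _ ⟩
      cellChips x (v , i) ∸ deg' (v , i)
        ≡⟨ cong (_∸ deg' (v , i)) (cellChips-unfired x v i v≢s i≡) ⟩
      ((deg' (v , i) ∸ T v (toℕ i)) + incoming x v (toℕ i)) ∸ deg' (v , i)
        ≡⟨ unfired-fire _ _ _ (T≤deg' v i v≢s) ⟩
      incoming x v (toℕ i) ∸ T v (toℕ i)
        ≡⟨ cong (_∸ T v (toℕ i)) (sym no-path-chips) ⟩
      incoming y v (toℕ i) ∸ T v (toℕ i)
        ≡⟨ sym (cellValue-yes _ _ _ (toℕ i <? y v) x<y) ⟩
      cellValue (deg' (v , i)) (T v (toℕ i)) (incoming y v (toℕ i)) (toℕ i <? y v)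
        ≡⟨ sym (cellChips-copy y v i v≢s) ⟩
      cellChips y (v , i) ∎
      where
      open ≡-Reasoning
      no-path-chips : incoming y v (toℕ i) ≡ incoming x v (toℕ i)
      no-path-chips = trans (incoming-self (toℕ i))
        (trans (cong (λ a → incoming x v (toℕ i) + pathW a (toℕ i)) (sym i≡))
               (trans (cong (incoming x v (toℕ i) +_) (pathW-self (toℕ i))) (+-identityʳ _)))

    after-sink : cellChips x sinkCell + E₂ (v , i) sinkCell ≡ cellChips y sinkCell
    after-sink = begin
      cellChips x sinkCell + E₂ (v , i) sinkCell ≡⟨ cong₂ _+_ (cellChips-sinkColumn x zero) (E₂-toSink v i v≢s) ⟩
      sinkChips x + W v (toℕ i)                  ≡⟨ cong (λ a → sinkChips x + W v a) i≡ ⟩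
      sinkChips x + W v (x v)                    ≡⟨ sym sinkChips-step ⟩
      sinkChips y                                ≡⟨ sym (cellChips-sinkColumn y zero) ⟩
      cellChips y sinkCell                       ∎
      where open ≡-Reasoning

    after-leaf : ∀ k → cellChips x (s , suc k) + E₂ (v , i) (s , suc k) ≡ cellChips y (s , suc k)
    after-leaf k = trans (cong₂ _+_ (cellChips-sinkColumn x (suc k)) (E₂-toLeaf v i k v≢s))
                         (sym (cellChips-sinkColumn y (suc k)))

    after-sibling : ∀ j → toℕ j ≢ x v → cellChips x (v , j) + E₂ (v , i) (v , j) ≡ cellChips y (v , j)
    after-sibling j j≢ = begin
      cellChips x (v , j) + E₂ (v , i) (v , j)
        ≡⟨ cong₂ _+_ (cellChips-copy x v j v≢s) (trans (E₂-path v i j v≢s) (cong (λ a → pathW a (toℕ j)) i≡)) ⟩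
      cellValue (deg' (v , j)) (T v (toℕ j)) (incoming x v (toℕ j)) (toℕ j <? x v) + pathW (x v) (toℕ j)
        ≡⟨ cellValue-receive _ _ _ _ (toℕ j <? x v) (toℕ j <? y v)
             (λ j<x → subst (toℕ j <_) (sym (bump-self x v)) (<-trans j<x (n<1+n _)))
             (λ j<y → ≤∧≢⇒< (s≤s⁻¹ (subst (toℕ j <_) (bump-self x v) j<y)) j≢)
             (fired-met vs c ex v (toℕ j)) ⟩
      cellValue (deg' (v , j)) (T v (toℕ j)) (incoming x v (toℕ j) + pathW (x v) (toℕ j)) (toℕ j <? y v)
        ≡⟨ cong (λ q → cellValue (deg' (v , j)) (T v (toℕ j)) q (toℕ j <? y v)) (sym (incoming-self (toℕ j))) ⟩
      cellValue (deg' (v , j)) (T v (toℕ j)) (incoming y v (toℕ j)) (toℕ j <? y v)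
        ≡⟨ sym (cellChips-copy y v j v≢s) ⟩
      cellChips y (v , j) ∎
      where open ≡-Reasoning

    after-other : ∀ u j → u ≢ s → u ≢ v → cellChips x (u , j) + E₂ (v , i) (u , j) ≡ cellChips y (u , j)
    after-other u j u≢s u≢v = begin
      cellChips x (u , j) + E₂ (v , i) (u , j)
        ≡⟨ cong₂ _+_ (cellChips-copy x u j u≢s) (E₂-other v i u j v≢s u≢s (λ e → u≢v (sym e))) ⟩
      cellValue (deg' (u , j)) (T u (toℕ j)) (incoming x u (toℕ j)) (toℕ j <? x u) + E v u
        ≡⟨ cellValue-receive _ _ _ _ (toℕ j <? x u) (toℕ j <? y u)
             (subst (toℕ j <_) (sym (bump-other x v u u≢v))) (subst (toℕ j <_) (bump-other x v u u≢v))
             (fired-met vs c ex u (toℕ j)) ⟩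
      cellValue (deg' (u , j)) (T u (toℕ j)) (incoming x u (toℕ j) + E v u) (toℕ j <? y u)
        ≡⟨ cong (λ q → cellValue (deg' (u , j)) (T u (toℕ j)) q (toℕ j <? y u)) (sym (incoming-other u (toℕ j) u≢v)) ⟩
      cellValue (deg' (u , j)) (T u (toℕ j)) (incoming y u (toℕ j)) (toℕ j <? y u)
        ≡⟨ sym (cellChips-copy y u j u≢s) ⟩
      cellChips y (u , j) ∎
      where open ≡-Reasoning

    after-cell : ∀ p → encode p ≢ z → cellChips x p + E₂ (v , i) p ≡ cellChips y p
    after-cell (u , j) = by-cases (u ≟ s) (u ≟ v) j
      where
      by-cases : Dec (u ≡ s) → Dec (u ≡ v) → ∀ j → encode (u , j) ≢ z →
                 cellChips x (u , j) + E₂ (v , i) (u , j) ≡ cellChips y (u , j)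
      by-cases (yes refl) _ zero _ = after-sink
      by-cases (yes refl) _ (suc k) _ = after-leaf k
      by-cases (no u≢s) (no u≢v) j _ = after-other u j u≢s u≢v
      by-cases (no u≢s) (yes refl) j p≢z = after-sibling j
        (λ j≡ → p≢z (cong (λ a → encode (v , a)) (toℕ-injective (trans j≡ (sym i≡)))))

    fire-image : fire E' z (image x) ≡ image (cnt (vs ++ v ∷ []))
    fire-image = trans (vec-ext _ _ at) (image-cong y _ (λ w → sym (cnt-snoc vs v w)))
      where
      at-cell : ∀ p → lookup (fire E' z (image x)) (encode p) ≡ cellChips y p
      at-cell p with encode p ≟ z
      ... | yes p≡z = subst (λ q → lookup (fire E' z (image x)) (encode q) ≡ cellChips y q)
                            (sym (encode-injective p (v , i) p≡z)) after-self
      ... | no p≢z = trans (fire-other E' z (image x) (encode p) p≢z)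
                           (trans (cong₂ _+_ (lookup-image x p) (E'-encode (v , i) p)) (after-cell p p≢z))
      at : ∀ w → lookup (fire E' z (image x)) w ≡ lookup (image y) w
      at w = trans (cong (lookup (fire E' z (image x))) (sym (encode-decode w)))
               (trans (at-cell (decode w)) (sym (trans (cong (lookup (image y)) (sym (encode-decode w)))
                                                      (lookup-image y (decode w)))))

  copy-firable : ∀ vs c → Exec E O vs c → ∀ v → Firable E v c → ∀ i → toℕ i ≡ cnt vs v →
                 Firable E' (encode (v , i)) (image (cnt vs))
  copy-firable vs c ex v f i i≡ = not-sink , enough
    where
    v≢s = firable-not-sink v c f
    not-sink : ¬ IsSink E' (encode (v , i))
    not-sink sink = 0≢1+n (trans (sym (sink sink' (λ e → v≢s (sym (cong proj₁ (encode-injective sinkCell (v , i) e))))))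
                                 (trans (E'-encode (v , i) sinkCell) (E₂-toSink v i v≢s)))
    enough : deg' (v , i) ≤ lookup (image (cnt vs)) (encode (v , i))
    enough = ≤-trans
      (met⇒unfired-firable _ _ _ (T≤deg' v i v≢s)
        (subst (λ a → T v a ≤ incoming (cnt vs) v a) (sym i≡) (firable⇒next-met vs c ex v (proj₂ f))))
      (≤-reflexive (sym (trans (lookup-image (cnt vs) (v , i)) (cellChips-unfired (cnt vs) v i v≢s i≡))))

  record NextCopy (vs : List (Fin n)) (c : Config n) (p : Cell) : Set where
    field
      is-next : toℕ (proj₂ p) ≡ cnt vs (proj₁ p)
      vertex-firable : Firable E (proj₁ p) c

  module _ (vs : List (Fin n)) (c : Config n) (ex : Exec E O vs c) where
    private
      x : Fin n → ℕ
      x = cnt vs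

    sink-column-stable : ∀ j → ¬ Firable E' (encode (s , j)) (image x)
    sink-column-stable zero (not-sink , _) =
      not-sink (λ w _ → trans (cong (λ q → E₂ q (decode w)) (decode-encode sinkCell)) (E₂-fromSinkColumn zero (decode w)))
    sink-column-stable (suc k) (_ , enough) = 1+n≰n {0} (≤-trans one-edge
      (≤-trans enough (≤-reflexive (trans (lookup-image x (s , suc k)) (cellChips-sinkColumn x (suc k))))))
      where
      one-edge : 1 ≤ deg' (s , suc k)
      one-edge = ≤-trans (≤-reflexive (sym (leaf-to-sink k))) (E₂≤deg' (s , suc k) sinkCell)

    -- A fired copy holds at most 3B chips, less than its degree.
    fired-copy-stable : ∀ u j → u ≢ s → toℕ j < x u → ¬ Firable E' (encode (u , j)) (image x)
    fired-copy-stable u j u≢s j<x (_ , enough) = <⇒≱ small (≤-trans enough (≤-reflexive holds))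
      where
      holds : lookup (image x) (encode (u , j)) ≡ incoming x u (toℕ j) ∸ T u (toℕ j)
      holds = trans (lookup-image x (u , j)) (trans (cellChips-copy x u j u≢s) (cellValue-yes _ _ _ (toℕ j <? x u) j<x))
      small : incoming x u (toℕ j) ∸ T u (toℕ j) < deg' (u , j)
      small = ≤-trans (s≤s (≤-trans (m∸n≤m (incoming x u (toℕ j)) (T u (toℕ j)))
                (≤-trans (incoming≤3B vs c ex u (toℕ j)) (m≤m+n _ _)))) (W≤deg' u j u≢s)

    -- A copy beyond the next one misses its predecessor's B chips.
    future-copy-stable : ∀ u j → u ≢ s → x u < toℕ j → ¬ Firable E' (encode (u , j)) (image x)
    future-copy-stable u j u≢s x<j (_ , enough) = <⇒≱ (fromOthers<B vs c ex u) (≤-trans (B≤T (toℕ j) x<j) met)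
      where
      only-others : incoming x u (toℕ j) ≡ fromOthers u x
      only-others = trans (cong₂ (λ a b → fromOthers u x + a + b)
                             (fromPred-unfired (toℕ j) (x u) x<j) (fromSucc-unfired (toℕ j) (x u) x<j))
                          (trans (+-identityʳ _) (+-identityʳ _))
      met : T u (toℕ j) ≤ fromOthers u x
      met = unfired-firable⇒met _ _ _ (T≤deg' u j u≢s)
              (≤-trans enough (≤-reflexive (trans (lookup-image x (u , j)) (trans (cellChips-copy x u j u≢s)
                (trans (cellValue-no _ _ _ (toℕ j <? x u) (<⇒≯ x<j)) (cong (_ +_) only-others))))))
      B≤T : ∀ a → x u < a → B ≤ T u a
      B≤T (suc k) _ = m≤m+n B _

    next-copy-firable : ∀ u j → u ≢ s → toℕ j ≡ x u → Firable E' (encode (u , j)) (image x) → Firable E u c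
    next-copy-firable u j u≢s j≡ (_ , enough) = (λ sink → u≢s (uniq u sink)) ,
      next-met⇒firable vs c ex u (subst (λ a → T u a ≤ incoming x u a) j≡ met)
      where
      met : T u (toℕ j) ≤ incoming x u (toℕ j)
      met = unfired-firable⇒met _ _ _ (T≤deg' u j u≢s)
              (≤-trans enough (≤-reflexive (trans (lookup-image x (u , j)) (cellChips-unfired x u j u≢s j≡))))

    firable-copy : ∀ p → Firable E' (encode p) (image x) → NextCopy vs c p
    firable-copy (u , j) F = by-cases (u ≟ s) j F
      where
      by-cases : Dec (u ≡ s) → ∀ j → Firable E' (encode (u , j)) (image x) → NextCopy vs c (u , j)
      by-cases (yes refl) j F = ⊥-elim (sink-column-stable j F)
      by-cases (no u≢s) j F with <-cmp (toℕ j) (x u)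
      ... | tri< j<x _ _ = ⊥-elim (fired-copy-stable u j u≢s j<x F)
      ... | tri> _ _ x<j = ⊥-elim (future-copy-stable u j u≢s x<j F)
      ... | tri≈ _ j≡ _ = record { is-next = j≡ ; vertex-firable = next-copy-firable u j u≢s j≡ F }

  forward : ∀ p c₀ → Exec E O p c₀ → ∀ ws c → Exec E c₀ ws c →
            ∃ λ zs → Exec E' (image (cnt p)) zs (image (cnt (p ++ ws)))
  forward p c₀ ex [] c done =
    [] , subst (λ q → Exec E' (image (cnt p)) [] (image (cnt q))) (sym (++-identityʳ p)) done
  forward p c₀ ex (v ∷ ws) c (step f rest) =
    encode (v , i) ∷ proj₁ IH ,
    step (copy-firable p c₀ ex v f i i≡)
      (subst₂ (λ a b → Exec E' a (proj₁ IH) (image (cnt b)))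
              (sym (FireCopy.fire-image p c₀ ex v f i i≡)) (++-assoc p (v ∷ []) ws) (proj₂ IH))
    where
    i = proj₁ (nextCopy p c₀ ex v)
    i≡ = proj₂ (nextCopy p c₀ ex v)
    IH = forward (p ++ v ∷ []) (fire E v c₀) (exec-snoc v ex f) ws c rest

  Fired : (Fin n → ℕ) → Fin m → Set
  Fired x z = toℕ (proj₂ (decode z)) < x (proj₁ (decode z))

  record Backward (p : List (Fin n)) (c₀ : Config n) (zs : List (Fin m)) (d : Config m) : Set where
    field
      es : List (Fin n)
      c : Config n
      exec : Exec E c₀ es c
      is-image : d ≡ image (cnt (p ++ es))
      unique : Unique zs
      fresh : All (λ z → ¬ Fired (cnt p) z) zs

  backward : ∀ p c₀ → Exec E O p c₀ → ∀ zs d → Exec E' (image (cnt p)) zs d → Backward p c₀ zs d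
  backward p c₀ ex [] d done = record
    { es = [] ; c = c₀ ; exec = done ; is-image = cong (λ q → image (cnt q)) (sym (++-identityʳ p))
    ; unique = [] ; fresh = [] }
  backward p c₀ ex (z ∷ zs) d (step F rest) = record
      { es = u ∷ Backward.es IH
      ; c = Backward.c IH
      ; exec = step fE (Backward.exec IH)
      ; is-image = trans (Backward.is-image IH) (cong (λ q → image (cnt q)) (++-assoc p (u ∷ []) (Backward.es IH)))
      ; unique = All.map (λ fresh-z' z'≡z → fresh-z' (subst (Fired (cnt p′)) z'≡z z-fired)) (Backward.fresh IH)
                 ∷ Backward.unique IH
      ; fresh = (λ z-fired-before → <-irrefl (NextCopy.is-next N) z-fired-before)
                ∷ All.map (λ fresh-z' fired → fresh-z' (fired-mono _ fired)) (Backward.fresh IH) }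
    where
    u = proj₁ (decode z)
    j = proj₂ (decode z)
    p′ = p ++ u ∷ []
    N = firable-copy p c₀ ex (u , j) (subst (λ w → Firable E' w (image (cnt p))) (sym (encode-decode z)) F)
    fE = NextCopy.vertex-firable N
    fired-image : fire E' z (image (cnt p)) ≡ image (cnt p′)
    fired-image = trans (cong (λ w → fire E' w (image (cnt p))) (sym (encode-decode z)))
                        (FireCopy.fire-image p c₀ ex u fE j (NextCopy.is-next N))
    IH = backward p′ (fire E u c₀) (exec-snoc u ex fE) zs d (subst (λ c → Exec E' c zs d) fired-image rest)
    z-fired : Fired (cnt p′) z
    z-fired = subst (_< cnt p′ u) (sym (NextCopy.is-next N))
      (≤-reflexive (sym (trans (cnt-snoc p u u) (trans (cong (cnt p u +_) (δ-same u)) (+-comm (cnt p u) 1)))))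
    fired-mono : ∀ z' → Fired (cnt p) z' → Fired (cnt p′) z'
    fired-mono z' fired = ≤-trans fired (≤-trans (m≤m+n _ _) (≤-reflexive (sym (cnt-snoc p u (proj₁ (decode z'))))))

  -- The image determines the shot vector: the next copy of u under p is
  -- unfired (holding more than 3B chips) and would be fired under q.
  image-shots-≤ : ∀ p q c d → Exec E O p c → Exec E O q d → image (cnt p) ≡ image (cnt q) →
                  ∀ u → cnt q u ≤ cnt p u
  image-shots-≤ p q c d exp exq same u with u ≟ s
  ... | yes refl = ≤-reflexive (trans (sink-never-fires s s-sink O q d exq) (sym (sink-never-fires s s-sink O p c exp)))
  ... | no u≢s = ≮⇒≥ q-not-ahead
    where
    i = proj₁ (nextCopy p c exp u)
    i≡ = proj₂ (nextCopy p c exp u)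
    much : suc (B + B + B) ≤ cellChips (cnt p) (u , i)
    much = ≤-trans (≤-reflexive (sym (m+n∸n≡m (suc (B + B + B)) (T u (toℕ i)))))
             (≤-trans (∸-monoˡ-≤ (T u (toℕ i)) (W≤deg' u i u≢s))
               (≤-trans (m≤m+n _ _) (≤-reflexive (sym (cellChips-unfired (cnt p) u i u≢s i≡)))))
    same-cell : cellChips (cnt p) (u , i) ≡ cellChips (cnt q) (u , i)
    same-cell = trans (sym (lookup-image (cnt p) (u , i)))
                      (trans (cong (λ v → lookup v (encode (u , i))) same) (lookup-image (cnt q) (u , i)))
    q-not-ahead : ¬ (cnt p u < cnt q u)
    q-not-ahead p<q = <⇒≱ (≤-trans much (≤-reflexive same-cell)) (≤-trans
      (≤-reflexive (trans (cellChips-copy (cnt q) u i u≢s)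
                          (cellValue-yes _ _ _ (toℕ i <? cnt q u) (subst (_< cnt q u) (sym i≡) p<q))))
      (≤-trans (m∸n≤m (incoming (cnt q) u (toℕ i)) (T u (toℕ i))) (incoming≤3B q d exq u (toℕ i))))

  image-injective : ∀ p q c d → Exec E O p c → Exec E O q d → image (cnt p) ≡ image (cnt q) → c ≡ d
  image-injective p q c d exp exq same = balance-determines (cnt p) (cnt q) c d
    (λ u → ≤-antisym (image-shots-≤ q p d c exq exp (sym same) u) (image-shots-≤ p q c d exp exq same u))
    (balanced-reach p c exp) (balanced-reach q d exq)

  to-sink : ∀ a → a ≢ sink' → 0 < E' a sink'
  to-sink a a≢sink = subst (0 <_) (sym (cong (E₂ (decode a)) (decode-encode sinkCell)))
    (by-cases (proj₁ (decode a) ≟ s) (proj₂ (decode a)) (λ e → a≢sink (trans (sym (encode-decode a)) (cong encode e))))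
    where
    by-cases : ∀ {u} → Dec (u ≡ s) → ∀ j → (u , j) ≢ sinkCell → 0 < E₂ (u , j) sinkCell
    by-cases (yes refl) zero p≢sink = ⊥-elim (p≢sink refl)
    by-cases (yes refl) (suc k) p≢sink = ≤-reflexive (sym (leaf-to-sink k))
    by-cases {u} (no u≢s) j p≢sink = subst (0 <_) (sym (E₂-toSink u j u≢s)) (s≤s z≤n)

  sink'-sink : IsSink E' sink'
  sink'-sink w _ = trans (cong (λ q → E₂ q (decode w)) (decode-encode sinkCell)) (E₂-fromSinkColumn zero (decode w))

  connected' : Connected E'
  connected' a b = toward a ◅◅ away b
    where
    toward : ∀ a → Star (Adj E') a sink'
    toward a with a ≟ sink'
    ... | yes refl = ε
    ... | no a≢sink = inj₁ (to-sink a a≢sink) ◅ ε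
    away : ∀ b → Star (Adj E') sink' b
    away b with b ≟ sink'
    ... | yes refl = ε
    ... | no b≢sink = inj₂ (to-sink b b≢sink) ◅ ε

  sink'-unique : ∀ v → IsSink E' v → v ≡ sink'
  sink'-unique v v-sink with v ≟ sink'
  ... | yes v≡sink = v≡sink
  ... | no v≢sink = ⊥-elim (<-irrefl (sym (v-sink sink' (λ e → v≢sink (sym e)))) (to-sink v v≢sink))

  leaf-to-copy : ∀ k u j → u ≢ s → E₂ (s , suc k) (u , j) ≡ 0
  leaf-to-copy k u j u≢s = trans (E₂-fromSinkColumn (suc k) (u , j)) row
    where
    row : leafRow (suc k) (u , j) ≡ 0
    row with u ≟ s
    ... | yes u≡s = ⊥-elim (u≢s u≡s)
    ... | no _ = refl

  leaf-to-leaf : ∀ k k' → E₂ (s , suc k) (s , suc k') ≡ 0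
  leaf-to-leaf k k' = trans (E₂-fromSinkColumn (suc k) (s , suc k')) row
    where
    row : leafRow (suc k) (s , suc k') ≡ 0
    row with s ≟ s
    ... | yes _ = refl
    ... | no _ = refl

  E₂-symmetric : ∀ p q → p ≢ q → p ≢ sinkCell → q ≢ sinkCell → E₂ p q ≡ E₂ q p
  E₂-symmetric (u , j) (u' , j') = by-cases (u ≟ s) (u' ≟ s) j j'
    where
    by-cases : Dec (u ≡ s) → Dec (u' ≡ s) → ∀ j j' → (u , j) ≢ (u' , j') → (u , j) ≢ sinkCell →
               (u' , j') ≢ sinkCell → E₂ (u , j) (u' , j') ≡ E₂ (u' , j') (u , j)
    by-cases (yes refl) _ zero j' _ p≢sink _ = ⊥-elim (p≢sink refl)
    by-cases _ (yes refl) j zero _ _ q≢sink = ⊥-elim (q≢sink refl)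
    by-cases (yes refl) (yes refl) (suc k) (suc k') _ _ _ = trans (leaf-to-leaf k k') (sym (leaf-to-leaf k' k))
    by-cases (yes refl) (no u'≢s) (suc k) j' _ _ _ = trans (leaf-to-copy k u' j' u'≢s) (sym (E₂-toLeaf u' j' k u'≢s))
    by-cases (no u≢s) (yes refl) j (suc k') _ _ _ = trans (E₂-toLeaf u j k' u≢s) (sym (leaf-to-copy k' u j u≢s))
    by-cases (no u≢s) (no u'≢s) j j' _ _ _ with u ≟ u'
    ... | yes refl = trans (E₂-path u j j' u≢s) (trans (pathW-sym (toℕ j) (toℕ j')) (sym (E₂-path u j' j u≢s)))
    ... | no u≢u' = trans (E₂-other u j u' j' u≢s u'≢s u≢u')
                      (trans (symm u u' u≢u' u≢s u'≢s) (sym (E₂-other u' j' u j u'≢s u≢s (λ e → u≢u' (sym e)))))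

  isASM' : IsASM E' O'
  isASM' = connected' , sink' , sink'-sink , sink'-unique , symmetric
    where
    decode-≢ : ∀ a b → a ≢ b → decode a ≢ decode b
    decode-≢ a b a≢b e = a≢b (trans (sym (encode-decode a)) (trans (cong encode e) (encode-decode b)))
    symmetric : ∀ a b → a ≢ b → a ≢ sink' → b ≢ sink' → E' a b ≡ E' b a
    symmetric a b a≢b a≢sink b≢sink = E₂-symmetric (decode a) (decode b) (decode-≢ a b a≢b)
      (λ e → a≢sink (trans (sym (encode-decode a)) (cong encode e)))
      (λ e → b≢sink (trans (sym (encode-decode b)) (cong encode e)))

  simple' : Simple E' O'
  simple' zs d ex _ = Backward.unique (backward [] O done zs d ex)

  equivalent : Equivalent E O E' O'
  equivalent = to , from , from-to , to-from , reach⇔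
    where
    to : CFG E O → CFG E' O'
    to (c , vs , ex) = image (cnt vs) , forward [] O done vs c ex
    back : ∀ {zs d} → Exec E' O' zs d → Backward [] O zs d
    back {zs} {d} ex = backward [] O done zs d ex
    from : CFG E' O' → CFG E O
    from (d , zs , ex) = Backward.c (back ex) , Backward.es (back ex) , Backward.exec (back ex)
    from-to : ∀ x → proj₁ (from (to x)) ≡ proj₁ x
    from-to (c , vs , ex) = image-injective (Backward.es r) vs (Backward.c r) c (Backward.exec r) ex
                              (sym (Backward.is-image r))
      where r = back (proj₂ (forward [] O done vs c ex))
    to-from : ∀ y → proj₁ (to (from y)) ≡ proj₁ y
    to-from (d , zs , ex) = sym (Backward.is-image (back ex))
    reach⇔ : ∀ x y → Reach E (proj₁ x) (proj₁ y) ⇔ Reach E' (proj₁ (to x)) (proj₁ (to y))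
    reach⇔ (ca , vsa , exa) (cb , vsb , exb) = mk⇔ forth backth
      where
      forth : Reach E ca cb → Reach E' (image (cnt vsa)) (image (cnt vsb))
      forth (ws , exw) = proj₁ F , subst (Exec E' (image (cnt vsa)) (proj₁ F))
          (image-cong _ _ (shots-unique (vsa ++ ws) vsb cb (exec-++ exa exw) exb)) (proj₂ F)
        where F = forward vsa ca exa ws cb exw
      backth : Reach E' (image (cnt vsa)) (image (cnt vsb)) → Reach E ca cb
      backth (zs , ex') = Backward.es r , subst (Exec E ca (Backward.es r)) c≡cb (Backward.exec r)
        where
        r = backward vsa ca exa zs _ ex'
        c≡cb : Backward.c r ≡ cb
        c≡cb = image-injective (vsa ++ Backward.es r) vsb (Backward.c r) cb
                 (exec-++ exa (Backward.exec r)) exb (sym (Backward.is-image r))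

mainTheorem5 : ∀ (n : ℕ) (E : Graph n) (O : Config n) → IsASM E O →
    Σ ℕ λ m → Σ (Graph m) λ E' → Σ (Config m) λ O' →
    IsASM E' O' × Simple E' O' × Equivalent E O E' O'
mainTheorem5 n E O (conn , s , s-sink , uniq , symm) =
  m , E' , O' , isASM' , simple' , equivalent
  where open SimpleModel E O s s-sink symm conn uniq
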